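{- If $G$ is a connected bipartite graph of even size with partition classes $A$ and $B$, then there exists a balanced forest $F\subseteq G$, all of whose leaves lie in $A$, such that in $G-E(F)$ all vertices in $A$ have even degree.
   Context: All graphs are finite and simple. The size of a graph is its number of edges. A forest is balanced if it has a bipartition such that all vertices in one of the partition classes have even degree. -}

module Defs where

open import Data.Bool using (Bool; true; false; if_then_else_; _∧_; not)
open import Data.Nat using (ℕ; _≤_; _<ᵇ_)
open import Data.Nat.ListAction using (sum)
open import Data.Nat.Divisibility using (_∣_)
open import Data.Fin using (Fin; toℕ)
open import Data.List using (List; []; _∷_; map; allFin; length; _∷ʳ_)
open import Data.List.Relation.Unary.Unique.Propositional using (Unique)
open import Data.Product using (Σ; _×_; ∃)
open import Relation.Binary.PropositionalEquality using (_≡_; _≢_)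
open import Relation.Binary.Construct.Closure.ReflexiveTransitive using (Star)
open import Relation.Nullary using (¬_)

record Graph (n : ℕ) : Set where
  field
    adj   : Fin n → Fin n → Bool
    sym   : ∀ u v → adj u v ≡ adj v u
    irrefl : ∀ v → adj v v ≡ false
open Graph public

Even : ℕ → Set
Even k = 2 ∣ k

deg : ∀ {n} → Graph n → Fin n → ℕ
deg {n} G v = sum (map (λ u → if adj G v u then 1 else 0) (allFin n))

size : ∀ {n} → Graph n → ℕ
size {n} G = sum (map (λ u → sum (map (λ v → if (toℕ u <ᵇ toℕ v) ∧ adj G u v then 1 else 0) (allFin n))) (allFin n))

Connected : ∀ {n} → Graph n → Set
Connected G = ∀ u v → Star (λ x y → adj G x y ≡ true) u v

-- a 2-colouring side such that every edge joins the two classes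
-- (class A = vertices with side true, class B = side false)
IsBipartition : ∀ {n} → Graph n → (Fin n → Bool) → Set
IsBipartition G side = ∀ u v → adj G u v ≡ true → side u ≢ side v

data Chain {n} (G : Graph n) : List (Fin n) → Set where
  []  : Chain G []
  [-] : ∀ v → Chain G (v ∷ [])
  _∷_ : ∀ {u v vs} → adj G u v ≡ true → Chain G (v ∷ vs) → Chain G (u ∷ v ∷ vs)

IsCycle : ∀ {n} → Graph n → Fin n → List (Fin n) → Set
IsCycle G v vs = 2 ≤ length vs × Unique (v ∷ vs) × Chain G (v ∷ vs ∷ʳ v)

Forest : ∀ {n} → Graph n → Set
Forest G = ∀ v vs → ¬ IsCycle G v vs

-- F is a subgraph of G (F spans all vertices of G; only edge set matters)
_⊆G_ : ∀ {n} → Graph n → Graph n → Set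
F ⊆G G = ∀ u v → adj F u v ≡ true → adj G u v ≡ true

Balanced : ∀ {n} → Graph n → Set
Balanced F = Σ (_ → Bool) λ col → IsBipartition F col ×
  Σ Bool (λ b → ∀ v → col v ≡ b → Even (deg F v))

removeEdges : ∀ {n} → Graph n → Graph n → Graph n
removeEdges G F = record
  { adj = λ u v → adj G u v ∧ not (adj F u v)
  ; sym = λ u v → lemma u v
  ; irrefl = λ v → irr v }
  where
  open import Relation.Binary.PropositionalEquality using (cong₂)
  lemma : ∀ u v → (adj G u v ∧ not (adj F u v)) ≡ (adj G v u ∧ not (adj F v u))
  lemma u v = cong₂ (λ x y → x ∧ not y) (sym G u v) (sym F u v)
  irr : ∀ v → (adj G v v ∧ not (adj F v v)) ≡ false
  irr v with adj G v v | irrefl G v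
  ... | false | _ = _≡_.refl

-- Let T be the set of vertices of A of odd degree in G.  Every edge has exactly one end
-- in A, so |T| ≡ |E(G)| ≡ 0 (mod 2), and connectivity gives a T-join of G: an edge set
-- whose odd-degree vertices are exactly T (the mod-2 sum of walks from each t ∈ T to a
-- fixed root).  A T-join with fewest edges is a forest, since deleting a cycle keeps all
-- degree parities.  It is balanced (every vertex of B has even degree in it), its leaves
-- have odd degree and so lie in T ⊆ A, and deleting it from G makes every vertex of A even.
module Submission where

open import Defs hiding (sym)
open import Algebra.Bundles using (CommutativeRing)
open import Data.Bool using (Bool; true; false; not; _∧_; _xor_; if_then_else_)
open import Data.Bool.Properties
  using ( xor-∧-commutativeRing; xor-assoc; xor-comm; xor-same; xor-identityʳ
        ; not-distribˡ-xor; not-involutive; ∧-comm; ∧-conicalˡ; ∧-conicalʳ; ∧-zeroʳ; ∧-identityʳ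
        ; ∧-distribˡ-xor; ∧-distribʳ-xor )
  renaming (_≟_ to _≟ᴮ_)
open import Data.Empty using (⊥-elim)
open import Data.Fin using (Fin; zero; suc; toℕ)
open import Data.Fin.Properties using (_≟_; all?; toℕ-injective)
open import Data.Fin.Subset.Properties using (anySubset?)
open import Data.List using (List; []; _∷_; map; tabulate; _∷ʳ_)
import Data.Nat.ListAction as List
open import Data.List.Relation.Unary.All using (All; []; _∷_)
open import Data.List.Relation.Unary.All.Properties using (∷ʳ⁺)
open import Data.List.Relation.Unary.AllPairs using (_∷_)
open import Data.Nat using (ℕ; zero; suc; _+_; _*_; _≤_; _<_; _<ᵇ_; z≤n; s≤s)
open import Data.Nat.Divisibility using (divides; _∣0; ∣-refl; ∣m∣n⇒∣m+n)
open import Data.Nat.Induction using (<-wellFounded)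
open import Data.Nat.Properties
  using (+-*-semiring; _<?_; ≤⇒≯; ≮⇒≥; +-mono-≤; +-mono-<-≤; +-mono-≤-<)
import Algebra.Properties.Semiring.Sum +-*-semiring as ℕ-Sum
open import Data.Product using (Σ; ∃; ∃₂; _×_; _,_; proj₂)
open import Data.Sum using (_⊎_; inj₁; inj₂)
open import Data.Vec using (Vec; []; _∷_; lookup)
import Data.Vec as Vec
open import Data.Vec.Properties using (lookup∘tabulate)
open import Function using (_∘_; _on_)
open import Induction.WellFounded using (Acc; acc)
open import Relation.Binary.Construct.Closure.ReflexiveTransitive using (Star; ε; _◅_)
import Relation.Binary.Construct.On as On
open import Relation.Binary.PropositionalEquality
  using (_≡_; _≢_; refl; sym; trans; cong; cong₂; subst; ≢-sym; module ≡-Reasoning)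
open import Relation.Nullary using (Dec; does; yes; no)
open import Relation.Nullary.Decidable using (map′; dec-true; dec-false; _×-dec_; _→-dec_)
open import Relation.Unary using (Decidable)

open import Algebra.Properties.Semiring.Sum (CommutativeRing.semiring xor-∧-commutativeRing)

isOdd : ℕ → Bool
isOdd zero    = false
isOdd (suc k) = not (isOdd k)

isOdd-+ : ∀ m k → isOdd (m + k) ≡ isOdd m xor isOdd k
isOdd-+ zero    k = refl
isOdd-+ (suc m) k = trans (cong not (isOdd-+ m k)) (not-distribˡ-xor (isOdd m) (isOdd k))

isOdd-if : ∀ b → isOdd (if b then 1 else 0) ≡ b
isOdd-if true  = refl
isOdd-if false = refl

isOdd≡false⇒even : ∀ {k} → isOdd k ≡ false → Even k
isOdd≡false⇒even {zero}          _ = 2 ∣0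
isOdd≡false⇒even {suc (suc k)} e =
  ∣m∣n⇒∣m+n ∣-refl (isOdd≡false⇒even (trans (sym (not-involutive (isOdd k))) e))

even⇒isOdd≡false : ∀ {k} → Even k → isOdd k ≡ false
even⇒isOdd≡false (divides q refl) = isOdd-*2 q
  where
  isOdd-*2 : ∀ q → isOdd (q * 2) ≡ false
  isOdd-*2 zero    = refl
  isOdd-*2 (suc q) = trans (not-involutive (isOdd (q * 2))) (isOdd-*2 q)

isOdd-sum : ∀ {A : Set} {n} (g : Fin n → A) (f : A → ℕ) →
  isOdd (List.sum (map f (tabulate g))) ≡ ∑[ i < n ] isOdd (f (g i))
isOdd-sum {n = zero}  g f = refl
isOdd-sum {n = suc n} g f =
  trans (isOdd-+ (f (g zero)) _) (cong (isOdd (f (g zero)) xor_) (isOdd-sum (g ∘ suc) f))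

-- Sums over GF(2) = (Bool, xor, ∧)

∑-true : ∀ {n} (f : Fin n → Bool) → ∑[ i < n ] f i ≡ true → ∃ λ i → f i ≡ true
∑-true {suc n} f s with f zero in f₀
... | true  = zero , f₀
... | false with ∑-true (f ∘ suc) s
...   | i , fi = suc i , fi

δ : ∀ {n} → Fin n → Fin n → Bool
δ u v = does (u ≟ v)

δ-sym : ∀ {n} (u v : Fin n) → δ u v ≡ δ v u
δ-sym u v with u ≟ v | v ≟ u
... | yes _   | yes _   = refl
... | no _    | no _    = refl
... | yes u≡v | no v≢u  = ⊥-elim (v≢u (sym u≡v))
... | no u≢v  | yes v≡u = ⊥-elim (u≢v (sym v≡u))

∑-δ : ∀ {n} (f : Fin n → Bool) (v : Fin n) → ∑[ u < n ] (f u ∧ δ u v) ≡ f v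
∑-δ {suc n} f zero = begin
  f zero ∧ true xor ∑[ u < n ] (f (suc u) ∧ false)
    ≡⟨ cong₂ _xor_ (∧-identityʳ (f zero)) ∑-false ⟩
  f zero xor false
    ≡⟨ xor-identityʳ (f zero) ⟩
  f zero ∎
  where
  open ≡-Reasoning
  ∑-false : ∑[ u < n ] (f (suc u) ∧ false) ≡ false
  ∑-false = trans (sum-cong-≗ (∧-zeroʳ ∘ f ∘ suc)) (sum-replicate-zero n)
∑-δ {suc n} f (suc v) =
  trans (cong (_xor ∑[ u < n ] (f (suc u) ∧ δ u v)) (∧-zeroʳ (f zero))) (∑-δ (f ∘ suc) v)

≢⇒xor≡true : ∀ {x y} → x ≢ y → x xor y ≡ true
≢⇒xor≡true {true}  {true}  x≢y = ⊥-elim (x≢y refl)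
≢⇒xor≡true {true}  {false} _   = refl
≢⇒xor≡true {false} {true}  _   = refl
≢⇒xor≡true {false} {false} x≢y = ⊥-elim (x≢y refl)

xor-cancel-middle : ∀ x y z → (x xor y) xor (y xor z) ≡ x xor z
xor-cancel-middle x y z = trans (xor-assoc x y (y xor z))
  (cong (x xor_) (trans (sym (xor-assoc y y z)) (cong (_xor z) (xor-same y))))

xor-⊆ : ∀ {x y} → (y ≡ true → x ≡ true) → x xor y ≡ true → x ≡ true
xor-⊆ {true}           _   _ = refl
xor-⊆ {false} {true}  y⇒x _ = y⇒x refl
xor-⊆ {false} {false} _   ()

∧-not≡xor : ∀ {x y} → (y ≡ true → x ≡ true) → x ∧ not y ≡ x xor y
∧-not≡xor {true}  {true}  _   = refl
∧-not≡xor {true}  {false} _   = refl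
∧-not≡xor {false} {true}  y⇒x = y⇒x refl
∧-not≡xor {false} {false} _   = refl

-- Edge sets as Boolean adjacency matrices

Mat : ℕ → Set
Mat n = Fin n → Fin n → Bool

∂ : ∀ {n} → Mat n → Fin n → Bool
∂ {n} M v = ∑[ w < n ] M v w

isOdd-deg : ∀ {n} (G : Graph n) v → isOdd (deg G v) ≡ ∂ (adj G) v
isOdd-deg G v =
  trans (isOdd-sum (λ u → u) (λ u → if adj G v u then 1 else 0)) (sum-cong-≗ (isOdd-if ∘ adj G v))

_⊆_ : ∀ {n} → Mat n → Mat n → Set
C ⊆ M = ∀ u w → C u w ≡ true → M u w ≡ true

_⊕_ : ∀ {n} → Mat n → Mat n → Mat n
(M ⊕ N) u w = M u w xor N u w

∂-⊕ : ∀ {n} (M N : Mat n) v → ∂ (M ⊕ N) v ≡ ∂ M v xor ∂ N v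
∂-⊕ M N v = ∑-distrib-+ (M v) (N v)

edge : ∀ {n} → Fin n → Fin n → Mat n
edge a b u w = (δ u a ∧ δ w b) xor (δ u b ∧ δ w a)

edge-sym : ∀ {n} (a b u w : Fin n) → edge a b u w ≡ edge a b w u
edge-sym a b u w =
  trans (xor-comm (δ u a ∧ δ w b) _) (cong₂ _xor_ (∧-comm (δ u b) _) (∧-comm (δ u a) _))

∂-edge : ∀ {n} (a b v : Fin n) → ∂ (edge a b) v ≡ δ v a xor δ v b
∂-edge {n} a b v = begin
  ∑[ w < n ] ((δ v a ∧ δ w b) xor (δ v b ∧ δ w a))
    ≡⟨ ∑-distrib-+ (λ w → δ v a ∧ δ w b) (λ w → δ v b ∧ δ w a) ⟩
  ∑[ w < n ] (δ v a ∧ δ w b) xor ∑[ w < n ] (δ v b ∧ δ w a)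
    ≡⟨ cong₂ _xor_ (*-distribˡ-sum (δ v a) (λ w → δ w b)) (*-distribˡ-sum (δ v b) (λ w → δ w a)) ⟨
  (δ v a ∧ ∑[ w < n ] δ w b) xor (δ v b ∧ ∑[ w < n ] δ w a)
    ≡⟨ cong₂ _xor_ (cong (δ v a ∧_) (∑-δ _ b)) (cong (δ v b ∧_) (∑-δ _ a)) ⟩
  (δ v a ∧ true) xor (δ v b ∧ true)
    ≡⟨ cong₂ _xor_ (∧-identityʳ (δ v a)) (∧-identityʳ (δ v b)) ⟩
  δ v a xor δ v b ∎
  where open ≡-Reasoning

edge-true : ∀ {n} {a b u w : Fin n} → edge a b u w ≡ true → (u ≡ a × w ≡ b) ⊎ (u ≡ b × w ≡ a)
edge-true {a = a} {b} {u} {w} e with u ≟ a | w ≟ b | u ≟ b | w ≟ a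
... | yes u≡a | yes w≡b | _       | _       = inj₁ (u≡a , w≡b)
... | _       | _       | yes u≡b | yes w≡a = inj₂ (u≡b , w≡a)
... | no _    | _       | no _    | _       with () ← e
... | no _    | _       | yes _   | no _    with () ← e
... | yes _   | no _    | no _    | _       with () ← e
... | yes _   | no _    | yes _   | no _    with () ← e

edge-self : ∀ {n} {a b : Fin n} → a ≢ b → edge a b a b ≡ true
edge-self {a = a} {b} a≢b
  rewrite dec-true (a ≟ a) refl | dec-true (b ≟ b) refl | dec-false (a ≟ b) a≢b = refl

edge-∌ : ∀ {n} {a b w : Fin n} u → w ≢ a → w ≢ b → edge a b u w ≡ false
edge-∌ {a = a} {b} {w} u w≢a w≢b
  rewrite dec-false (w ≟ a) w≢a | dec-false (w ≟ b) w≢b | ∧-zeroʳ (δ u a) | ∧-zeroʳ (δ u b) = refl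

-- Counts ordered pairs, hence twice the number of edges.
weight : ∀ {n} → Mat n → ℕ
weight M = ℕ-Sum.sum (λ u → ℕ-Sum.sum (λ w → if M u w then 1 else 0))

sum-mono-≤ : ∀ {n} {f g : Fin n → ℕ} → (∀ i → f i ≤ g i) → ℕ-Sum.sum f ≤ ℕ-Sum.sum g
sum-mono-≤ {zero}  _   = z≤n
sum-mono-≤ {suc n} f≤g = +-mono-≤ (f≤g zero) (sum-mono-≤ (f≤g ∘ suc))

sum-mono-< : ∀ {n} {f g : Fin n → ℕ} → (∀ i → f i ≤ g i) → ∀ j → f j < g j →
  ℕ-Sum.sum f < ℕ-Sum.sum g
sum-mono-< f≤g zero    fj<gj = +-mono-<-≤ fj<gj (sum-mono-≤ (f≤g ∘ suc))
sum-mono-< f≤g (suc j) fj<gj = +-mono-≤-< (f≤g zero) (sum-mono-< (f≤g ∘ suc) j fj<gj)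

weight-⊕-< : ∀ {n} {M C : Mat n} → C ⊆ M → ∀ {u w} → C u w ≡ true →
  weight (M ⊕ C) < weight M
weight-⊕-< {M = M} {C} C⊆M {u} {w} uw∈C =
  sum-mono-< (λ u → sum-mono-≤ (entry≤ u)) u (sum-mono-< (entry≤ u) w entry<)
  where
  entry≤ : ∀ u w → (if M u w xor C u w then 1 else 0) ≤ (if M u w then 1 else 0)
  entry≤ u w with M u w in uw∈M | C u w in uw∈C
  ... | true  | true  = z≤n
  ... | true  | false = s≤s z≤n
  ... | false | false = z≤n
  ... | false | true  with () ← trans (sym (C⊆M u w uw∈C)) uw∈M
  entry< : (if M u w xor C u w then 1 else 0) < (if M u w then 1 else 0)
  entry< rewrite uw∈C | C⊆M u w uw∈C = s≤s z≤n

module _ {n} {R : Fin n → Fin n → Set} where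

  walkEdges : ∀ {a b} → Star R a b → Mat n
  walkEdges ε                 = λ _ _ → false
  walkEdges (_◅_ {a} {c} _ s) = edge a c ⊕ walkEdges s

  walkEdges-sym : ∀ {a b} (s : Star R a b) u w → walkEdges s u w ≡ walkEdges s w u
  walkEdges-sym ε                 u w = refl
  walkEdges-sym (_◅_ {a} {c} _ s) u w = cong₂ _xor_ (edge-sym a c u w) (walkEdges-sym s u w)

  ∂-walkEdges : ∀ {a b} (s : Star R a b) v → ∂ (walkEdges s) v ≡ δ v a xor δ v b
  ∂-walkEdges {a} ε v = trans (sum-replicate-zero n) (sym (xor-same (δ v a)))
  ∂-walkEdges (_◅_ {a} {c} {b} _ s) v = begin
    ∂ (edge a c ⊕ walkEdges s) v             ≡⟨ ∂-⊕ (edge a c) (walkEdges s) v ⟩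
    ∂ (edge a c) v xor ∂ (walkEdges s) v     ≡⟨ cong₂ _xor_ (∂-edge a c v) (∂-walkEdges s v) ⟩
    (δ v a xor δ v c) xor (δ v c xor δ v b)  ≡⟨ xor-cancel-middle (δ v a) (δ v c) (δ v b) ⟩
    δ v a xor δ v b                          ∎
    where open ≡-Reasoning

Adjacent : ∀ {n} → Graph n → Fin n → Fin n → Set
Adjacent G u v = adj G u v ≡ true

walkEdges-⊆ : ∀ {n} (G : Graph n) {a b} (s : Star (Adjacent G) a b) u w →
  walkEdges s u w ≡ true → adj G u w ≡ true
walkEdges-⊆ G (_◅_ {a} {c} a~c s) u w uw∈s with edge a c u w in uw∈ac
... | false = walkEdges-⊆ G s u w uw∈s
... | true with edge-true {a = a} {c} {u} {w} uw∈ac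
...   | inj₁ (refl , refl) = a~c
...   | inj₂ (refl , refl) = trans (Graph.sym G c a) a~c

module Cycle {n} (F : Graph n) where

  chain⇒walk : ∀ {a b} l → Chain F (a ∷ l ∷ʳ b) → Star (Adjacent F) a b
  chain⇒walk []      (a~b ∷ [-] _) = a~b ◅ ε
  chain⇒walk (c ∷ l) (a~c ∷ ch)    = a~c ◅ chain⇒walk l ch

  walkEdges-∌ : ∀ {a b w} l (ch : Chain F (a ∷ l ∷ʳ b)) → All (w ≢_) (a ∷ l ∷ʳ b) →
    ∀ u → walkEdges (chain⇒walk l ch) u w ≡ false
  walkEdges-∌ []      (_ ∷ [-] _) (w≢a ∷ w≢b ∷ []) u = cong (_xor false) (edge-∌ u w≢a w≢b)
  walkEdges-∌ (c ∷ l) (_ ∷ ch)    (w≢a ∷ w∉ch@(w≢c ∷ _)) u =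
    cong₂ _xor_ (edge-∌ u w≢a w≢c) (walkEdges-∌ l ch w∉ch u)

  cycleEdges : ∀ {v vs} → IsCycle F v vs → Mat n
  cycleEdges {vs = vs} (_ , _ , ch) = walkEdges (chain⇒walk vs ch)

  cycleEdges-sym : ∀ {v vs} (c : IsCycle F v vs) u w → cycleEdges c u w ≡ cycleEdges c w u
  cycleEdges-sym {vs = vs} (_ , _ , ch) = walkEdges-sym (chain⇒walk vs ch)

  cycleEdges-⊆ : ∀ {v vs} (c : IsCycle F v vs) u w → cycleEdges c u w ≡ true → adj F u w ≡ true
  cycleEdges-⊆ {vs = vs} (_ , _ , ch) = walkEdges-⊆ F (chain⇒walk vs ch)

  ∂-cycleEdges : ∀ {v vs} (c : IsCycle F v vs) u → ∂ (cycleEdges c) u ≡ false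
  ∂-cycleEdges {v} {vs} (_ , _ , ch) u =
    trans (∂-walkEdges (chain⇒walk vs ch) u) (xor-same (δ u v))

  -- The first edge v v₁ of the cycle is not cancelled by any later one, as v₁ occurs only once.
  cycleEdges-nonempty : ∀ {v vs} (c : IsCycle F v vs) → ∃₂ λ u w → cycleEdges c u w ≡ true
  cycleEdges-nonempty {vs = []}         (() , _)
  cycleEdges-nonempty {vs = _ ∷ []}     (s≤s () , _)
  cycleEdges-nonempty {v} {v₁ ∷ v₂ ∷ vs}
    (_ , ((v≢v₁ ∷ v≢v₂ ∷ _) ∷ (v₁≢v₂ ∷ v₁∉vs) ∷ _) , _ ∷ _ ∷ ch) =
    v , v₁ , cong₂ _xor_ (edge-self v≢v₁)
      (cong₂ _xor_ (trans (edge-sym v₁ v₂ v v₁) (edge-∌ v₁ v≢v₁ v≢v₂))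
                   (walkEdges-∌ vs ch (v₁≢v₂ ∷ ∷ʳ⁺ v₁∉vs (≢-sym v≢v₁)) v))

<ᵇ-connex : ∀ {m k} → m ≢ k → (m <ᵇ k) xor (k <ᵇ m) ≡ true
<ᵇ-connex {zero}  {zero}  m≢k = ⊥-elim (m≢k refl)
<ᵇ-connex {zero}  {suc k} _   = refl
<ᵇ-connex {suc m} {zero}  _   = refl
<ᵇ-connex {suc m} {suc k} m≢k = <ᵇ-connex (m≢k ∘ cong suc)

_<ᶠ_ : ∀ {n} → Fin n → Fin n → Bool
u <ᶠ v = toℕ u <ᵇ toℕ v

∑∑-upper-triangle : ∀ {n} (g : Fin n → Fin n → Bool) → (∀ v → g v v ≡ false) →
  ∑[ v < n ] ∑[ u < n ] g v u ≡ ∑[ v < n ] ∑[ u < n ] (v <ᶠ u ∧ (g v u xor g u v))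
∑∑-upper-triangle {n} g g-loopless = begin
  ∑[ v < n ] ∑[ u < n ] g v u
    ≡⟨ ∑∑-cong split ⟩
  ∑[ v < n ] ∑[ u < n ] ((v <ᶠ u ∧ g v u) xor (u <ᶠ v ∧ g v u))
    ≡⟨ ∑∑-distrib-xor _ _ ⟩
  ∑[ v < n ] ∑[ u < n ] (v <ᶠ u ∧ g v u) xor ∑[ v < n ] ∑[ u < n ] (u <ᶠ v ∧ g v u)
    ≡⟨ cong (∑[ v < n ] ∑[ u < n ] (v <ᶠ u ∧ g v u) xor_) (∑-comm (λ v u → u <ᶠ v ∧ g v u)) ⟩
  ∑[ v < n ] ∑[ u < n ] (v <ᶠ u ∧ g v u) xor ∑[ v < n ] ∑[ u < n ] (v <ᶠ u ∧ g u v)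
    ≡⟨ sym (∑∑-distrib-xor _ _) ⟩
  ∑[ v < n ] ∑[ u < n ] ((v <ᶠ u ∧ g v u) xor (v <ᶠ u ∧ g u v))
    ≡⟨ ∑∑-cong (λ v u → sym (∧-distribˡ-xor (v <ᶠ u) (g v u) (g u v))) ⟩
  ∑[ v < n ] ∑[ u < n ] (v <ᶠ u ∧ (g v u xor g u v)) ∎
  where
  open ≡-Reasoning
  ∑∑-cong : ∀ {f h : Fin n → Fin n → Bool} → (∀ v u → f v u ≡ h v u) →
    ∑[ v < n ] ∑[ u < n ] f v u ≡ ∑[ v < n ] ∑[ u < n ] h v u
  ∑∑-cong f≡h = sum-cong-≗ (λ v → sum-cong-≗ (f≡h v))
  ∑∑-distrib-xor : ∀ (f h : Fin n → Fin n → Bool) → ∑[ v < n ] ∑[ u < n ] (f v u xor h v u) ≡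
    ∑[ v < n ] ∑[ u < n ] f v u xor ∑[ v < n ] ∑[ u < n ] h v u
  ∑∑-distrib-xor f h = trans (sum-cong-≗ (λ v → ∑-distrib-+ (f v) (h v)))
                              (∑-distrib-+ (λ v → ∑[ u < n ] f v u) (λ v → ∑[ u < n ] h v u))
  split : ∀ v u → g v u ≡ (v <ᶠ u ∧ g v u) xor (u <ᶠ v ∧ g v u)
  split v u = trans (comparable v u) (∧-distribʳ-xor (g v u) (v <ᶠ u) (u <ᶠ v))
    where
    comparable : ∀ v u → g v u ≡ ((v <ᶠ u) xor (u <ᶠ v)) ∧ g v u
    comparable v u with v ≟ u
    ... | yes refl = trans (g-loopless v) (sym (cong (_∧ g v v) (xor-same (v <ᶠ v))))
    ... | no v≢u   = sym (cong (_∧ g v u) (<ᵇ-connex (v≢u ∘ toℕ-injective)))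

module _ {n} (G : Graph n) (side : Fin n → Bool) (bip : IsBipartition G side) where

  edge-crosses : ∀ v u → (side v ∧ adj G v u) xor (side u ∧ adj G u v) ≡ adj G v u
  edge-crosses v u rewrite Graph.sym G u v with adj G v u in e
  ... | false = cong₂ _xor_ (∧-zeroʳ (side v)) (∧-zeroʳ (side u))
  ... | true  = trans (cong₂ _xor_ (∧-identityʳ (side v)) (∧-identityʳ (side u)))
                      (≢⇒xor≡true (bip v u e))

  ∑-side-∂ : ∑[ v < n ] (side v ∧ ∂ (adj G) v) ≡ ∑[ v < n ] ∑[ u < n ] (v <ᶠ u ∧ adj G v u)
  ∑-side-∂ = begin
    ∑[ v < n ] (side v ∧ ∂ (adj G) v)
      ≡⟨ sum-cong-≗ (λ v → *-distribˡ-sum (side v) (adj G v)) ⟩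
    ∑[ v < n ] ∑[ u < n ] (side v ∧ adj G v u)
      ≡⟨ ∑∑-upper-triangle (λ v u → side v ∧ adj G v u)
                  (λ v → trans (cong (side v ∧_) (irrefl G v)) (∧-zeroʳ (side v))) ⟩
    ∑[ v < n ] ∑[ u < n ] (v <ᶠ u ∧ ((side v ∧ adj G v u) xor (side u ∧ adj G u v)))
      ≡⟨ sum-cong-≗ (λ v → sum-cong-≗ (λ u → cong (v <ᶠ u ∧_) (edge-crosses v u))) ⟩
    ∑[ v < n ] ∑[ u < n ] (v <ᶠ u ∧ adj G v u) ∎
    where open ≡-Reasoning

  even-size⇒∑-side-∂≡false : Even (size G) → ∑[ v < n ] (side v ∧ ∂ (adj G) v) ≡ false
  even-size⇒∑-side-∂≡false even = begin
    ∑[ v < n ] (side v ∧ ∂ (adj G) v)             ≡⟨ ∑-side-∂ ⟩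
    ∑[ v < n ] ∑[ u < n ] (v <ᶠ u ∧ adj G v u)   ≡⟨ isOdd-size ⟨
    isOdd (size G)                                ≡⟨ even⇒isOdd≡false even ⟩
    false                                         ∎
    where
    open ≡-Reasoning
    isOdd-size : isOdd (size G) ≡ ∑[ v < n ] ∑[ u < n ] (v <ᶠ u ∧ adj G v u)
    isOdd-size = trans (isOdd-sum (λ v → v) row) (sum-cong-≗ λ v →
                   trans (isOdd-sum (λ u → u) (entry v)) (sum-cong-≗ (isOdd-if ∘ entry-bit v)))
      where
      entry-bit : Fin n → Fin n → Bool
      entry-bit v u = v <ᶠ u ∧ adj G v u
      entry : Fin n → Fin n → ℕ
      entry v u = if entry-bit v u then 1 else 0
      row : Fin n → ℕ
      row v = List.sum (map (entry v) (tabulate (λ u → u)))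

-- T-joins: edge sets of G whose odd-degree vertices are exactly those in T

record IsTJoin {n} (G : Graph n) (T : Fin n → Bool) (M : Mat n) : Set where
  field
    symmetric : ∀ u w → M u w ≡ M w u
    ⊆G        : ∀ u w → M u w ≡ true → adj G u w ≡ true
    ∂≡T       : ∀ v → ∂ M v ≡ T v

  loopless : ∀ v → M v v ≡ false
  loopless v with M v v in vv∈M
  ... | false = refl
  ... | true with () ← trans (sym (⊆G v v vv∈M)) (irrefl G v)

  graph : Graph n
  graph = record { adj = M ; sym = symmetric ; irrefl = loopless }

-- The mod-2 sum of walks from every t ∈ T to a fixed root.
TJoin-exists : ∀ {n} (G : Graph n) (T : Fin n → Bool) →
  Connected G → ∑[ t < n ] T t ≡ false → ∃ (IsTJoin G T)
TJoin-exists {zero}  G T _ _ = (λ ()) , record { symmetric = λ () ; ⊆G = λ () ; ∂≡T = λ () }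
TJoin-exists {suc n} G T connected ∑T≡false =
  J , record { symmetric = J-sym ; ⊆G = J-⊆G ; ∂≡T = ∂J≡T }
  where
  W : Fin (suc n) → Mat (suc n)
  W t = walkEdges (connected t zero)

  J : Mat (suc n)
  J u w = ∑[ t < suc n ] (T t ∧ W t u w)

  J-sym : ∀ u w → J u w ≡ J w u
  J-sym u w = sum-cong-≗ (λ t → cong (T t ∧_) (walkEdges-sym (connected t zero) u w))

  J-⊆G : ∀ u w → J u w ≡ true → adj G u w ≡ true
  J-⊆G u w uw∈J with ∑-true (λ t → T t ∧ W t u w) uw∈J
  ... | t , uw∈Wt = walkEdges-⊆ G (connected t zero) u w (∧-conicalʳ (T t) _ uw∈Wt)

  ∂J≡T : ∀ v → ∂ J v ≡ T v
  ∂J≡T v = begin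
    ∑[ w < suc n ] ∑[ t < suc n ] (T t ∧ W t v w)
      ≡⟨ ∑-comm (λ w t → T t ∧ W t v w) ⟩
    ∑[ t < suc n ] ∑[ w < suc n ] (T t ∧ W t v w)
      ≡⟨ sum-cong-≗ (λ t → *-distribˡ-sum (T t) (W t v)) ⟨
    ∑[ t < suc n ] (T t ∧ ∂ (W t) v)
      ≡⟨ sum-cong-≗ (λ t → cong (T t ∧_) (∂-walkEdges (connected t zero) v)) ⟩
    ∑[ t < suc n ] (T t ∧ (δ v t xor δ v zero))
      ≡⟨ sum-cong-≗ (λ t → ∧-distribˡ-xor (T t) (δ v t) (δ v zero)) ⟩
    ∑[ t < suc n ] ((T t ∧ δ v t) xor (T t ∧ δ v zero))
      ≡⟨ ∑-distrib-+ (λ t → T t ∧ δ v t) (λ t → T t ∧ δ v zero) ⟩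
    ∑[ t < suc n ] (T t ∧ δ v t) xor ∑[ t < suc n ] (T t ∧ δ v zero)
      ≡⟨ cong₂ _xor_ (trans (sum-cong-≗ (λ t → cong (T t ∧_) (δ-sym v t))) (∑-δ T v))
                     (sym (*-distribʳ-sum (δ v zero) T)) ⟩
    T v xor (∑[ t < suc n ] T t ∧ δ v zero)
      ≡⟨ cong (λ x → T v xor (x ∧ δ v zero)) ∑T≡false ⟩
    T v xor false
      ≡⟨ xor-identityʳ (T v) ⟩
    T v ∎
    where open ≡-Reasoning

module _ {n} {G : Graph n} {T : Fin n → Bool} {M : Mat n} (j : IsTJoin G T M) where
  open IsTJoin j

  TJoin-⊕-even : ∀ {C} → (∀ u w → C u w ≡ C w u) → C ⊆ M → (∀ v → ∂ C v ≡ false) →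
    IsTJoin G T (M ⊕ C)
  TJoin-⊕-even {C} C-sym C⊆M ∂C≡false = record
    { symmetric = λ u w → cong₂ _xor_ (symmetric u w) (C-sym u w)
    ; ⊆G        = λ u w → ⊆G u w ∘ xor-⊆ (C⊆M u w)
    ; ∂≡T       = λ v → trans (∂-⊕ M C v)
                    (trans (cong₂ _xor_ (∂≡T v) (∂C≡false v)) (xor-identityʳ (T v)))
    }

Exhaustible : Set → Set₁
Exhaustible A = ∀ {P : A → Set} → Decidable P → Dec (∃ P)

Vec-exhaustible : ∀ {A} → Exhaustible A → ∀ {k} → Exhaustible (Vec A k)
Vec-exhaustible search {zero}  P? = map′ ([] ,_) (λ { ([] , p) → p }) (P? [])
Vec-exhaustible search {suc k} P? =
  map′ (λ (a , as , p) → a ∷ as , p) (λ { (a ∷ as , p) → a , as , p })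
       (search (λ a → Vec-exhaustible search (λ as → P? (a ∷ as))))

∃-minimal : ∀ {A} (μ : A → ℕ) {P : A → Set} → Decidable P → Exhaustible A →
  ∀ {x} → P x → ∃ λ y → P y × (∀ {z} → P z → μ y ≤ μ z)
∃-minimal {A} μ {P} P? search {x} px = descend x (On.wellFounded μ <-wellFounded x) px
  where
  descend : ∀ x → Acc (_<_ on μ) x → P x → ∃ λ y → P y × (∀ {z} → P z → μ y ≤ μ z)
  descend x (acc smaller) px with search (λ y → P? y ×-dec μ y <? μ x)
  ... | yes (y , py , y<x) = descend y (smaller y<x) py
  ... | no  ∄y             = x , px , λ pz → ≮⇒≥ (λ z<x → ∄y (_ , pz , z<x))

-- Matrices are searched through this encoding: unlike functions, vectors are
-- exhaustible without function extensionality.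
decode : ∀ {n} → Vec (Vec Bool n) n → Mat n
decode V u w = lookup (lookup V u) w

encode : ∀ {n} → Mat n → Vec (Vec Bool n) n
encode M = Vec.tabulate (λ u → Vec.tabulate (M u))

decode-encode : ∀ {n} (M : Mat n) u w → decode (encode M) u w ≡ M u w
decode-encode M u w =
  trans (cong (λ row → lookup row w) (lookup∘tabulate _ u)) (lookup∘tabulate (M u) w)

weight-resp : ∀ {n} {M M′ : Mat n} → (∀ u w → M u w ≡ M′ u w) → weight M ≡ weight M′
weight-resp M≡M′ =
  ℕ-Sum.sum-cong-≗ (λ u → ℕ-Sum.sum-cong-≗ (λ w → cong (if_then 1 else 0) (M≡M′ u w)))

module _ {n} (G : Graph n) (T : Fin n → Bool) where

  IsTJoin-resp : ∀ {M M′} → (∀ u w → M u w ≡ M′ u w) → IsTJoin G T M → IsTJoin G T M′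
  IsTJoin-resp M≡M′ j = record
    { symmetric = λ u w → trans (sym (M≡M′ u w)) (trans (symmetric u w) (M≡M′ w u))
    ; ⊆G        = λ u w → ⊆G u w ∘ trans (M≡M′ u w)
    ; ∂≡T       = λ v → trans (sum-cong-≗ (sym ∘ M≡M′ v)) (∂≡T v)
    }
    where open IsTJoin j

  isTJoin? : Decidable (IsTJoin G T)
  isTJoin? M = map′ (λ (s , g , o) → record { symmetric = s ; ⊆G = g ; ∂≡T = o })
                    (λ j → IsTJoin.symmetric j , IsTJoin.⊆G j , IsTJoin.∂≡T j)
                    (all? (λ u → all? (λ w → M u w ≟ᴮ M w u))
                      ×-dec all? (λ u → all? (λ w → (M u w ≟ᴮ true) →-dec (adj G u w ≟ᴮ true)))
                      ×-dec all? (λ v → ∂ M v ≟ᴮ T v))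

  IsTJoin-encode : ∀ {M} → IsTJoin G T M → IsTJoin G T (decode (encode M))
  IsTJoin-encode = IsTJoin-resp (λ u w → sym (decode-encode _ u w))

  minimal-TJoin : ∀ {M} → IsTJoin G T M →
    ∃ λ M* → IsTJoin G T M* × (∀ {M′} → IsTJoin G T M′ → weight M* ≤ weight M′)
  minimal-TJoin {M} j
    with ∃-minimal (weight ∘ decode) (isTJoin? ∘ decode) (Vec-exhaustible anySubset?)
                   {encode M} (IsTJoin-encode j)
  ... | V , jV , V-minimal = decode V , jV , λ {M′} j′ →
    subst (weight (decode V) ≤_) (weight-resp (decode-encode M′))
          (V-minimal {encode M′} (IsTJoin-encode j′))

  minimal-TJoin-forest : ∀ {M} (j : IsTJoin G T M) →
    (∀ {M′} → IsTJoin G T M′ → weight M ≤ weight M′) → Forest (IsTJoin.graph j)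
  minimal-TJoin-forest j minimal v vs cycle =
    ≤⇒≯ (minimal (TJoin-⊕-even j (cycleEdges-sym cycle) (cycleEdges-⊆ cycle) (∂-cycleEdges cycle)))
        (weight-⊕-< (cycleEdges-⊆ cycle) (proj₂ (proj₂ (cycleEdges-nonempty cycle))))
    where open Cycle (IsTJoin.graph j)

module _ {n} (G : Graph n) (side : Fin n → Bool) (bip : IsBipartition G side) {M : Mat n}
         (j : IsTJoin G (λ v → side v ∧ ∂ (adj G) v) M) where
  open IsTJoin j

  isOdd-deg-TJoin : ∀ v → isOdd (deg graph v) ≡ side v ∧ ∂ (adj G) v
  isOdd-deg-TJoin v = trans (isOdd-deg graph v) (∂≡T v)

  TJoin-balanced : Balanced graph
  TJoin-balanced = side , (λ u w → bip u w ∘ ⊆G u w) , false ,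
    λ v v∈B → isOdd≡false⇒even (trans (isOdd-deg-TJoin v) (cong (_∧ ∂ (adj G) v) v∈B))

  TJoin-leaf : ∀ v → deg graph v ≡ 1 → side v ≡ true
  TJoin-leaf v deg≡1 = ∧-conicalˡ (side v) _ (trans (sym (isOdd-deg-TJoin v)) (cong isOdd deg≡1))

  TJoin-complement-even : ∀ v → side v ≡ true → Even (deg (removeEdges G graph) v)
  TJoin-complement-even v v∈A = isOdd≡false⇒even (begin
    isOdd (deg (removeEdges G graph) v)      ≡⟨ isOdd-deg (removeEdges G graph) v ⟩
    ∑[ u < n ] (adj G v u ∧ not (M v u))      ≡⟨ sum-cong-≗ (λ u → ∧-not≡xor (⊆G v u)) ⟩
    ∂ (adj G ⊕ M) v                           ≡⟨ ∂-⊕ (adj G) M v ⟩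
    d xor ∂ M v                               ≡⟨ cong (d xor_) (∂≡T v) ⟩
    d xor (side v ∧ d)                        ≡⟨ cong (λ b → d xor (b ∧ d)) v∈A ⟩
    d xor d                                   ≡⟨ xor-same d ⟩
    false                                     ∎)
    where
    open ≡-Reasoning
    d : Bool
    d = ∂ (adj G) v

corollary12 : ∀ {n} (G : Graph n) (side : Fin n → Bool) →
    Connected G → IsBipartition G side → Even (size G) →
    Σ (Graph n) λ F → F ⊆G G × Forest F × Balanced F ×
    (∀ v → deg F v ≡ 1 → side v ≡ true) ×
    (∀ v → side v ≡ true → Even (deg (removeEdges G F) v))
corollary12 {n} G side connected bip even =
  let _ , j          = TJoin-exists G T connected (even-size⇒∑-side-∂≡false G side bip even)
      _ , j* , minimal = minimal-TJoin G T j
  in IsTJoin.graph j* , IsTJoin.⊆G j* , minimal-TJoin-forest G T j* minimal ,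
     TJoin-balanced G side bip j* , TJoin-leaf G side bip j* , TJoin-complement-even G side bip j*
  where
  T : Fin n → Bool
  T v = side v ∧ ∂ (adj G) v
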